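{- Let $G$ be a bipartite graph that does not contain $C_4$ as a (not necessarily induced) subgraph. Then $\overset{\rightarrow}{\Gamma}_{LD}(G)=\alpha(G)$.
   Context: $\alpha(G)$ is the independence number. For an orientation $D$ of $G=(V,E)$ (each edge given exactly one direction), $S\subseteq V$ is locating-dominating in $D$ if every $u\notin S$ has an in-neighbour in $S$ and distinct $u,v\notin S$ have distinct sets of in-neighbours in $S$; $\gamma_{LD}(D)$ is the minimum size. $\overset{\rightarrow}{\Gamma}_{LD}(G)=\max_D\gamma_{LD}(D)$ over all orientations $D$ of $G$. -}

module Defs where

open import Data.Nat using (ℕ; _≤_)
open import Data.Bool using (Bool; true; false)
open import Data.Fin using (Fin)
open import Data.Fin.Subset using (Subset; _∈_; _∉_; ∣_∣)
open import Data.Product using (Σ; ∃; _×_; _,_)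
open import Data.Sum using (_⊎_)
open import Relation.Binary.PropositionalEquality using (_≡_; _≢_)
open import Relation.Nullary using (¬_)

record Graph (n : ℕ) : Set where
  field
    adj   : Fin n → Fin n → Bool
    sym   : ∀ u v → adj u v ≡ adj v u
    irrefl : ∀ u → adj u u ≡ false
open Graph public

Bipartite : ∀ {n} → Graph n → Set
Bipartite {n} G = Σ (Fin n → Bool) λ c →
  ∀ u v → adj G u v ≡ true → c u ≢ c v

HasC4 : ∀ {n} → Graph n → Set
HasC4 {n} G = Σ (Fin n) λ a → Σ (Fin n) λ b → Σ (Fin n) λ c → Σ (Fin n) λ d →
  (a ≢ b × a ≢ c × a ≢ d × b ≢ c × b ≢ d × c ≢ d) ×
  (adj G a b ≡ true × adj G b c ≡ true × adj G c d ≡ true × adj G d a ≡ true)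

Independent : ∀ {n} → Graph n → Subset n → Set
Independent {n} G I = ∀ u v → u ∈ I → v ∈ I → adj G u v ≡ false

IsIndependenceNumber : ∀ {n} → Graph n → ℕ → Set
IsIndependenceNumber {n} G k =
  (Σ (Subset n) λ I → Independent G I × ∣ I ∣ ≡ k) ×
  (∀ I → Independent G I → ∣ I ∣ ≤ k)

record Orientation {n : ℕ} (G : Graph n) : Set where
  field
    arc      : Fin n → Fin n → Bool
    arc⇒edge : ∀ u v → arc u v ≡ true → adj G u v ≡ true
    edge⇒arc : ∀ u v → adj G u v ≡ true → arc u v ≡ true ⊎ arc v u ≡ true
    antisym  : ∀ u v → arc u v ≡ true → arc v u ≡ false
open Orientation public

LocatingDominating : ∀ {n} {G : Graph n} → Orientation G → Subset n → Set
LocatingDominating {n} D S =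
  (∀ u → u ∉ S → Σ (Fin n) λ w → w ∈ S × arc D w u ≡ true) ×
  (∀ u v → u ∉ S → v ∉ S → u ≢ v →
     ¬ (∀ w → w ∈ S → arc D w u ≡ arc D w v))

IsLDNumber : ∀ {n} {G : Graph n} → Orientation G → ℕ → Set
IsLDNumber {n} D k =
  (Σ (Subset n) λ S → LocatingDominating D S × ∣ S ∣ ≡ k) ×
  (∀ S → LocatingDominating D S → k ≤ ∣ S ∣)

IsUpperOrientedLDNumber : ∀ {n} → Graph n → ℕ → Set
IsUpperOrientedLDNumber G k =
  (Σ (Orientation G) λ D → IsLDNumber D k) ×
  (∀ (D : Orientation G) (m : ℕ) → IsLDNumber D m → m ≤ k)

{-# OPTIONS --safe #-}
-- Let I be a maximum independent set, |I| = α.  Every LD set contains the sources, and orienting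
-- all edges away from I (the other edges by colour) makes every vertex of I a source, so some
-- orientation has γ_LD ≥ α.  Conversely, by Hall's theorem applied to each colour class, V ∖ I
-- can be matched into I.  In any orientation D, each matching edge has a head and a tail; the
-- heads are dominated by their tails, and the non-heads form an LD set of size at most |I|,
-- since two heads with the same in-neighbours among them would close a C4 with their tails.
module Submission where

open import Defs hiding (sym)
open import Data.Bool using (Bool; true; false; _∧_; _∨_; not; if_then_else_)
import Data.Bool.Properties as 𝔹
open import Data.Empty using (⊥; ⊥-elim)
open import Data.Fin using (Fin; zero; suc)
open import Data.Fin.Properties using (_≟_; any?; all?; suc-injective; 0≢1+n)
open import Data.Fin.Subset using (Subset; _∈_; _∉_; ∣_∣)
open import Data.Fin.Subset.Properties using (p⊆q⇒∣p∣≤∣q∣; anySubset?; _∈?_)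
open import Data.Nat using (ℕ; zero; suc; _+_; _≤_; _<_; z≤n; s≤s; _≤?_; _<?_)
open import Data.Nat.Properties
  using ( ≤-reflexive; ≤-trans; ≤-antisym; ≤-pred; <-≤-trans; ≰⇒>; ≮⇒≥; n≮0; m≤n⇒m≤1+n; m<n+m
        ; +-suc; +-mono-≤; +-monoˡ-≤; +-cancelˡ-≤; +-cancelʳ-≤; module ≤-Reasoning)
open import Data.Product using (Σ; ∃; _×_; _,_; proj₁; proj₂)
open import Data.Sum using (_⊎_; inj₁; inj₂)
open import Data.Vec using ([]; _∷_; lookup; tabulate)
open import Data.Vec.Properties using (lookup∘tabulate; []=⇒lookup; lookup⇒[]=)
open import Function using (_∘_)
open import Relation.Binary.PropositionalEquality
open import Relation.Nullary using (¬_; Dec; yes; no; does)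
open import Relation.Nullary.Decidable using (dec-true; dec-false; _×-dec_; _→-dec_)

private
  variable
    n : ℕ

∧-trueˡ : ∀ {a b} → a ∧ b ≡ true → a ≡ true
∧-trueˡ {true} _ = refl

∧-trueʳ : ∀ {a b} → a ∧ b ≡ true → b ≡ true
∧-trueʳ {true} e = e

∧-true : ∀ {a b} → a ≡ true → b ≡ true → a ∧ b ≡ true
∧-true refl refl = refl

not-true⇒false : ∀ {a} → not a ≡ true → a ≡ false
not-true⇒false {false} _ = refl

false⇒not-true : ∀ {a} → a ≡ false → not a ≡ true
false⇒not-true refl = refl

∖⁺ : ∀ {a b} → a ≡ true → b ≡ false → a ∧ not b ≡ true
∖⁺ a b = ∧-true a (false⇒not-true b)

true⇒≢false : ∀ {a} → a ≡ true → a ≢ false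
true⇒≢false refl ()

𝔹-cases : ∀ a → a ≡ true ⊎ a ≡ false
𝔹-cases true  = inj₁ refl
𝔹-cases false = inj₂ refl

∨-true⁻ : ∀ a {b} → a ∨ b ≡ true → a ≡ true ⊎ b ≡ true
∨-true⁻ true  _ = inj₁ refl
∨-true⁻ false e = inj₂ e

does⇒ : ∀ {ℓ} {A : Set ℓ} (a? : Dec A) → does a? ≡ true → A
does⇒ (yes a) _ = a
does⇒ (no _) ()

-- Finite sets as Boolean predicates

Pred𝔹 : ℕ → Set
Pred𝔹 n = Fin n → Bool

infixr 7 _∩_
infixr 6 _∪_ _∖_
infix 4 _⊆_

_∩_ _∪_ _∖_ : Pred𝔹 n → Pred𝔹 n → Pred𝔹 n
(P ∩ Q) x = P x ∧ Q x
(P ∪ Q) x = P x ∨ Q x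
(P ∖ Q) x = P x ∧ not (Q x)

∁ : Pred𝔹 n → Pred𝔹 n
∁ P x = not (P x)

⁅_⁆ : Fin n → Pred𝔹 n
⁅ y ⁆ x = does (x ≟ y)

_⊆_ : Pred𝔹 n → Pred𝔹 n → Set
P ⊆ Q = ∀ x → P x ≡ true → Q x ≡ true

_⊆?_ : (P Q : Pred𝔹 n) → Dec (P ⊆ Q)
P ⊆? Q = all? λ x → (P x 𝔹.≟ true) →-dec (Q x 𝔹.≟ true)

Disjoint : Pred𝔹 n → Pred𝔹 n → Set
Disjoint P Q = ∀ x → P x ≡ true → Q x ≡ true → ⊥

∈⁅⁆⇒≡ : ∀ {x y : Fin n} → ⁅ y ⁆ x ≡ true → x ≡ y
∈⁅⁆⇒≡ {x = x} {y} = does⇒ (x ≟ y)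

∈⁅self⁆ : ∀ (y : Fin n) → ⁅ y ⁆ y ≡ true
∈⁅self⁆ y = dec-true (y ≟ y) refl

≢⇒∉⁅⁆ : ∀ {x y : Fin n} → x ≢ y → ⁅ y ⁆ x ≡ false
≢⇒∉⁅⁆ {x = x} {y} = dec-false (x ≟ y)

any𝔹 : Pred𝔹 n → Bool
any𝔹 P = does (any? λ x → P x 𝔹.≟ true)

any𝔹-intro : ∀ (P : Pred𝔹 n) x → P x ≡ true → any𝔹 P ≡ true
any𝔹-intro P x Px = dec-true (any? λ x → P x 𝔹.≟ true) (x , Px)

any𝔹-elim : ∀ (P : Pred𝔹 n) → any𝔹 P ≡ true → ∃ λ x → P x ≡ true
any𝔹-elim P = does⇒ (any? λ x → P x 𝔹.≟ true)

count : Pred𝔹 n → ℕ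
count {zero}  P = 0
count {suc n} P = if P zero then suc (count (P ∘ suc)) else count (P ∘ suc)

count≤n : ∀ (P : Pred𝔹 n) → count P ≤ n
count≤n {zero}  P = z≤n
count≤n {suc n} P with P zero
... | true  = s≤s (count≤n (P ∘ suc))
... | false = m≤n⇒m≤1+n (count≤n (P ∘ suc))

count-cong : ∀ {P Q : Pred𝔹 n} → (∀ x → P x ≡ Q x) → count P ≡ count Q
count-cong {zero}          _ = refl
count-cong {suc n} {P} {Q} P≗Q rewrite P≗Q zero with Q zero
... | true  = cong suc (count-cong (P≗Q ∘ suc))
... | false = count-cong (P≗Q ∘ suc)

count-mono : ∀ {P Q : Pred𝔹 n} → P ⊆ Q → count P ≤ count Q
count-mono {zero}          _ = z≤n
count-mono {suc n} {P} {Q} P⊆Q with P zero in P0 | Q zero in Q0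
... | true  | true  = s≤s (count-mono (P⊆Q ∘ suc))
... | true  | false = ⊥-elim (true⇒≢false (P⊆Q zero P0) Q0)
... | false | true  = m≤n⇒m≤1+n (count-mono (P⊆Q ∘ suc))
... | false | false = count-mono (P⊆Q ∘ suc)

count-split : ∀ (P Q : Pred𝔹 n) → count P ≡ count (P ∩ Q) + count (P ∖ Q)
count-split {zero}  P Q = refl
count-split {suc n} P Q with P zero | Q zero
... | true  | true  = cong suc (count-split (P ∘ suc) (Q ∘ suc))
... | true  | false = trans (cong suc (count-split (P ∘ suc) (Q ∘ suc))) (sym (+-suc _ _))
... | false | _     = count-split (P ∘ suc) (Q ∘ suc)

count-∪ : ∀ (P Q : Pred𝔹 n) → Disjoint P Q → count (P ∪ Q) ≡ count P + count Q
count-∪ {zero}  P Q _ = refl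
count-∪ {suc n} P Q P∩Q=∅ with P zero in P0 | Q zero in Q0
... | true  | true  = ⊥-elim (P∩Q=∅ zero P0 Q0)
... | true  | false = cong suc (count-∪ (P ∘ suc) (Q ∘ suc) (P∩Q=∅ ∘ suc))
... | false | true  = trans (cong suc (count-∪ (P ∘ suc) (Q ∘ suc) (P∩Q=∅ ∘ suc))) (sym (+-suc _ _))
... | false | false = count-∪ (P ∘ suc) (Q ∘ suc) (P∩Q=∅ ∘ suc)

count-pos : ∀ (P : Pred𝔹 n) x → P x ≡ true → 0 < count P
count-pos P zero    Px rewrite Px = s≤s z≤n
count-pos P (suc x) Px with P zero
... | true  = s≤s z≤n
... | false = count-pos (P ∘ suc) x Px

count-pos⇒∃ : ∀ (P : Pred𝔹 n) → 0 < count P → ∃ λ x → P x ≡ true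
count-pos⇒∃ {suc n} P pos with P zero in P0
... | true  = zero , P0
... | false with count-pos⇒∃ (P ∘ suc) pos
...   | x , Px = suc x , Px

count-∅ : ∀ (P : Pred𝔹 n) → (∀ x → P x ≡ false) → count P ≡ 0
count-∅ {zero}  P _  = refl
count-∅ {suc n} P P=∅ rewrite P=∅ zero = count-∅ (P ∘ suc) (P=∅ ∘ suc)

count-⁅⁆ : ∀ (y : Fin n) → count ⁅ y ⁆ ≡ 1
count-⁅⁆ {suc n} zero    = cong suc (count-∅ (⁅_⁆ {suc n} zero ∘ suc) λ _ → refl)
count-⁅⁆ {suc n} (suc y) = count-⁅⁆ y

count-cover : ∀ (P Q : Pred𝔹 n) {A B : Pred𝔹 n} → P ∩ Q ⊆ A → P ∖ Q ⊆ B →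
  count P ≤ count A + count B
count-cover P Q P∩Q⊆A P∖Q⊆B =
  ≤-trans (≤-reflexive (count-split P Q)) (+-mono-≤ (count-mono P∩Q⊆A) (count-mono P∖Q⊆B))

count-∖< : ∀ (P Q : Pred𝔹 n) → 0 < count (P ∩ Q) → count (P ∖ Q) < count P
count-∖< P Q pos = subst (count (P ∖ Q) <_) (sym (count-split P Q)) (m<n+m _ pos)

count-remove : ∀ (P : Pred𝔹 n) y → P y ≡ true → count P ≡ suc (count (P ∖ ⁅ y ⁆))
count-remove P y Py =
  trans (count-split P ⁅ y ⁆)
        (cong (_+ count (P ∖ ⁅ y ⁆)) (trans (count-cong P∩⁅y⁆≗⁅y⁆) (count-⁅⁆ y)))
  where
  P∩⁅y⁆≗⁅y⁆ : ∀ x → (P ∩ ⁅ y ⁆) x ≡ ⁅ y ⁆ x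
  P∩⁅y⁆≗⁅y⁆ x with x ≟ y
  ... | yes refl rewrite Py = refl
  ... | no _     = 𝔹.∧-zeroʳ (P x)

count-injection : ∀ {m} (P : Pred𝔹 n) (Q : Pred𝔹 m) (f : Fin n → Fin m) →
  (∀ x → P x ≡ true → Q (f x) ≡ true) →
  (∀ x y → P x ≡ true → P y ≡ true → f x ≡ f y → x ≡ y) →
  count P ≤ count Q
count-injection {zero}  P Q f _ _ = z≤n
count-injection {suc n} P Q f maps injective with P zero in P0
... | false = count-injection (P ∘ suc) Q (f ∘ suc) (maps ∘ suc)
                (λ x y Px Py → suc-injective ∘ injective (suc x) (suc y) Px Py)
... | true rewrite count-remove Q (f zero) (maps zero P0) =
  s≤s (count-injection (P ∘ suc) (Q ∖ ⁅ f zero ⁆) (f ∘ suc) maps′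
         (λ x y Px Py → suc-injective ∘ injective (suc x) (suc y) Px Py))
  where
  maps′ : ∀ x → P (suc x) ≡ true → (Q ∖ ⁅ f zero ⁆) (f (suc x)) ≡ true
  maps′ x Px = ∖⁺ (maps (suc x) Px) (≢⇒∉⁅⁆ (0≢1+n ∘ sym ∘ injective (suc x) zero Px P0))

∣∣≡count-lookup : ∀ (p : Subset n) → ∣ p ∣ ≡ count (lookup p)
∣∣≡count-lookup []          = refl
∣∣≡count-lookup (true ∷ p)  = cong suc (∣∣≡count-lookup p)
∣∣≡count-lookup (false ∷ p) = ∣∣≡count-lookup p

∣tabulate∣≡count : ∀ (P : Pred𝔹 n) → ∣ tabulate P ∣ ≡ count P
∣tabulate∣≡count P = trans (∣∣≡count-lookup (tabulate P)) (count-cong (lookup∘tabulate P))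

∈-tabulate⁺ : ∀ (P : Pred𝔹 n) {x} → P x ≡ true → x ∈ tabulate P
∈-tabulate⁺ P {x} Px = lookup⇒[]= x (tabulate P) (trans (lookup∘tabulate P x) Px)

∈-tabulate⁻ : ∀ (P : Pred𝔹 n) {x} → x ∈ tabulate P → P x ≡ true
∈-tabulate⁻ P {x} x∈P = trans (sym (lookup∘tabulate P x)) ([]=⇒lookup x∈P)

-- Hall's theorem

module Hall {n : ℕ} (E : Fin n → Fin n → Bool) where

  N : Pred𝔹 n → Pred𝔹 n
  N Y z = any𝔹 λ y → Y y ∧ E y z

  N-intro : ∀ Y y z → Y y ≡ true → E y z ≡ true → N Y z ≡ true
  N-intro Y y z Yy Eyz = any𝔹-intro _ y (∧-true Yy Eyz)

  N-elim : ∀ Y z → N Y z ≡ true → ∃ λ y → Y y ≡ true × E y z ≡ true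
  N-elim Y z Nz with any𝔹-elim _ Nz
  ... | y , YEy = y , ∧-trueˡ YEy , ∧-trueʳ {Y y} YEy

  N-mono : ∀ {Y Y′} → Y ⊆ Y′ → N Y ⊆ N Y′
  N-mono {Y} {Y′} Y⊆Y′ z Nz with N-elim Y z Nz
  ... | y , Yy , Eyz = N-intro Y′ y z (Y⊆Y′ y Yy) Eyz

  N-∪ : ∀ Y Z z → N (Y ∪ Z) z ≡ true → N Y z ≡ true ⊎ N Z z ≡ true
  N-∪ Y Z z Nz with N-elim (Y ∪ Z) z Nz
  ... | y , Y∪Zy , Eyz with ∨-true⁻ (Y y) Y∪Zy
  ...   | inj₁ Yy = inj₁ (N-intro Y y z Yy Eyz)
  ...   | inj₂ Zy = inj₂ (N-intro Z y z Zy Eyz)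

  HallCondition : (L R : Pred𝔹 n) → Set
  HallCondition L R = ∀ Y → Y ⊆ L → count Y ≤ count (R ∩ N Y)

  hallCondition-⊆ : ∀ {L L′ R} → L′ ⊆ L → HallCondition L R → HallCondition L′ R
  hallCondition-⊆ L′⊆L hall Y Y⊆L′ = hall Y (λ x → L′⊆L x ∘ Y⊆L′ x)

  record Matching (L R : Pred𝔹 n) : Set where
    field
      mate           : Fin n → Fin n
      mate∈          : ∀ x → L x ≡ true → R (mate x) ≡ true
      mate-edge      : ∀ x → L x ≡ true → E x (mate x) ≡ true
      mate-injective : ∀ x y → L x ≡ true → L y ≡ true → mate x ≡ mate y → x ≡ y
  open Matching public

  matching-∅ : ∀ {L R} → (∀ x → L x ≡ true → ⊥) → Matching L R
  matching-∅ L=∅ = record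
    { mate           = λ x → x
    ; mate∈          = λ x → ⊥-elim ∘ L=∅ x
    ; mate-edge      = λ x → ⊥-elim ∘ L=∅ x
    ; mate-injective = λ x _ Lx → ⊥-elim (L=∅ x Lx)
    }

  matching-⊆ˡ : ∀ {L L′ R} → L′ ⊆ L → Matching L R → Matching L′ R
  matching-⊆ˡ L′⊆L m = record
    { mate           = mate m
    ; mate∈          = λ x → mate∈ m x ∘ L′⊆L x
    ; mate-edge      = λ x → mate-edge m x ∘ L′⊆L x
    ; mate-injective = λ x y Lx Ly → mate-injective m x y (L′⊆L x Lx) (L′⊆L y Ly)
    }

  matching-∩ʳ : ∀ {L R Q} → (∀ x y → L x ≡ true → E x y ≡ true → Q y ≡ true) →
    Matching L R → Matching L (R ∩ Q)
  matching-∩ʳ Q-closed m = record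
    { mate           = mate m
    ; mate∈          = λ x Lx → ∧-true (mate∈ m x Lx) (Q-closed x _ Lx (mate-edge m x Lx))
    ; mate-edge      = mate-edge m
    ; mate-injective = mate-injective m
    }

  matching-glue : ∀ {L R R₁ R₂} Y → Matching (L ∩ Y) R₁ → Matching (L ∖ Y) R₂ →
    R₁ ⊆ R → R₂ ⊆ R → Disjoint R₁ R₂ → Matching L R
  matching-glue {L} {R} {R₁} {R₂} Y m₁ m₂ R₁⊆R R₂⊆R R₁∩R₂=∅ = record
    { mate = mate′ ; mate∈ = mate′∈ ; mate-edge = mate′-edge ; mate-injective = mate′-injective }
    where
    mate′ : Fin n → Fin n
    mate′ x = if Y x then mate m₁ x else mate m₂ x

    mate′∈ : ∀ x → L x ≡ true → R (mate′ x) ≡ true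
    mate′∈ x Lx with Y x in Yx
    ... | true  = R₁⊆R _ (mate∈ m₁ x (∧-true Lx Yx))
    ... | false = R₂⊆R _ (mate∈ m₂ x (∖⁺ Lx Yx))

    mate′-edge : ∀ x → L x ≡ true → E x (mate′ x) ≡ true
    mate′-edge x Lx with Y x in Yx
    ... | true  = mate-edge m₁ x (∧-true Lx Yx)
    ... | false = mate-edge m₂ x (∖⁺ Lx Yx)

    mate′-injective : ∀ x y → L x ≡ true → L y ≡ true → mate′ x ≡ mate′ y → x ≡ y
    mate′-injective x y Lx Ly same with Y x in Yx | Y y in Yy
    ... | true  | true  = mate-injective m₁ x y (∧-true Lx Yx) (∧-true Ly Yy) same
    ... | false | false = mate-injective m₂ x y (∖⁺ Lx Yx) (∖⁺ Ly Yy) same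
    ... | true  | false =
      ⊥-elim (R₁∩R₂=∅ _ (mate∈ m₁ x (∧-true Lx Yx))
                         (subst (λ z → R₂ z ≡ true) (sym same) (mate∈ m₂ y (∖⁺ Ly Yy))))
    ... | false | true  =
      ⊥-elim (R₁∩R₂=∅ _ (mate∈ m₁ y (∧-true Ly Yy))
                         (subst (λ z → R₂ z ≡ true) same (mate∈ m₂ x (∖⁺ Lx Yx))))

  Critical : (L R Y : Pred𝔹 n) → Set
  Critical L R Y = Y ⊆ L × 0 < count Y × count (R ∩ N Y) ≤ count Y

  critical? : ∀ L R → Dec (∃ λ (p : Subset n) → Critical L R (lookup p))
  critical? L R = anySubset? λ p →
    (lookup p ⊆? L) ×-dec (0 <? count (lookup p)) ×-dec (count (R ∩ N (lookup p)) ≤? count (lookup p))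

  critical-transport : ∀ {L R Y Y′} → Y ⊆ Y′ → Y′ ⊆ Y → Critical L R Y → Critical L R Y′
  critical-transport {R = R} Y⊆Y′ Y′⊆Y (Y⊆L , pos , crit) =
    (λ x → Y⊆L x ∘ Y′⊆Y x) ,
    <-≤-trans pos (count-mono Y⊆Y′) ,
    ≤-trans (count-mono (λ z RNz → ∧-true (∧-trueˡ RNz) (N-mono Y′⊆Y z (∧-trueʳ {R z} RNz))))
            (≤-trans crit (count-mono Y⊆Y′))

  no-critical⇒surplus : ∀ {L R} → ¬ (∃ λ p → Critical L R (lookup p)) →
    ∀ Y → Y ⊆ L → 0 < count Y → count Y < count (R ∩ N Y)
  no-critical⇒surplus ∄ Y Y⊆L pos = ≰⇒> λ crit →
    ∄ (tabulate Y , critical-transport (λ x → trans (lookup∘tabulate Y x))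
                                       (λ x → trans (sym (lookup∘tabulate Y x)))
                                       (Y⊆L , pos , crit))

  hallCondition-residual : ∀ {L R Y} → HallCondition L R → Y ⊆ L → count (R ∩ N Y) ≤ count Y →
    HallCondition (L ∖ Y) (R ∖ N Y)
  hallCondition-residual {L} {R} {Y} hall Y⊆L crit Z Z⊆L∖Y = +-cancelˡ-≤ (count Y) _ _ (begin
    count Y + count Z                         ≡⟨ count-∪ Y Z Y∩Z=∅ ⟨
    count (Y ∪ Z)                             ≤⟨ hall (Y ∪ Z) Y∪Z⊆L ⟩
    count (R ∩ N (Y ∪ Z))                     ≤⟨ count-cover (R ∩ N (Y ∪ Z)) (N Y) inside outside ⟩
    count (R ∩ N Y) + count ((R ∖ N Y) ∩ N Z) ≤⟨ +-monoˡ-≤ _ crit ⟩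
    count Y + count ((R ∖ N Y) ∩ N Z)         ∎)
    where
    open ≤-Reasoning

    Y∩Z=∅ : Disjoint Y Z
    Y∩Z=∅ x Yx Zx = true⇒≢false Yx (not-true⇒false (∧-trueʳ {L x} (Z⊆L∖Y x Zx)))

    Y∪Z⊆L : Y ∪ Z ⊆ L
    Y∪Z⊆L x Y∪Zx with ∨-true⁻ (Y x) Y∪Zx
    ... | inj₁ Yx = Y⊆L x Yx
    ... | inj₂ Zx = ∧-trueˡ (Z⊆L∖Y x Zx)

    inside : (R ∩ N (Y ∪ Z)) ∩ N Y ⊆ R ∩ N Y
    inside z e = ∧-true (∧-trueˡ (∧-trueˡ e)) (∧-trueʳ {R z ∧ _} e)

    outside : (R ∩ N (Y ∪ Z)) ∖ N Y ⊆ (R ∖ N Y) ∩ N Z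
    outside z e with N-∪ Y Z z (∧-trueʳ {R z} (∧-trueˡ e))
    ... | inj₁ NYz = ⊥-elim (true⇒≢false NYz (not-true⇒false (∧-trueʳ {R z ∧ _} e)))
    ... | inj₂ NZz = ∧-true (∧-true (∧-trueˡ (∧-trueˡ e)) (∧-trueʳ {R z ∧ _} e)) NZz

  Hall≤ : ℕ → Set
  Hall≤ k = ∀ L R → count L ≤ k → HallCondition L R → Matching L R

  matching-from-critical : ∀ {k L R} → Hall≤ k → count L ≤ suc k → HallCondition L R →
    ∀ Y → Y ⊆ L → 0 < count Y → count Y ≤ k → count (R ∩ N Y) ≤ count Y → Matching L R
  matching-from-critical {k} {L} {R} hall≤k |L|≤1+k hall Y Y⊆L pos |Y|≤k crit =
    matching-glue Y onY offY (λ _ → ∧-trueˡ) (λ _ → ∧-trueˡ) R∩NY∩R∖NY=∅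
    where
    onY : Matching (L ∩ Y) (R ∩ N Y)
    onY = matching-⊆ˡ (λ x → ∧-trueʳ {L x})
            (matching-∩ʳ (N-intro Y) (hall≤k Y R |Y|≤k (hallCondition-⊆ Y⊆L hall)))

    |L∩Y|>0 : 0 < count (L ∩ Y)
    |L∩Y|>0 = <-≤-trans pos (count-mono (λ x Yx → ∧-true (Y⊆L x Yx) Yx))

    |L∖Y|≤k : count (L ∖ Y) ≤ k
    |L∖Y|≤k = ≤-pred (<-≤-trans (count-∖< L Y |L∩Y|>0) |L|≤1+k)

    offY : Matching (L ∖ Y) (R ∖ N Y)
    offY = hall≤k (L ∖ Y) (R ∖ N Y) |L∖Y|≤k (hallCondition-residual hall Y⊆L crit)

    R∩NY∩R∖NY=∅ : Disjoint (R ∩ N Y) (R ∖ N Y)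
    R∩NY∩R∖NY=∅ z in₁ in₂ = true⇒≢false (∧-trueʳ {R z} in₁) (not-true⇒false (∧-trueʳ {R z} in₂))

  matching-from-surplus : ∀ {k L R} → Hall≤ k → HallCondition L R → ∀ x₀ → L x₀ ≡ true →
    count (L ∖ ⁅ x₀ ⁆) ≤ k → (∀ Y → Y ⊆ L ∖ ⁅ x₀ ⁆ → 0 < count Y → count Y < count (R ∩ N Y)) →
    Matching L R
  matching-from-surplus {k} {L} {R} hall≤k hall x₀ Lx₀ |L∖x₀|≤k surplus =
    matching-glue ⁅ x₀ ⁆ onx₀ offx₀ ⁅r₀⁆⊆R (λ _ → ∧-trueˡ) ⁅r₀⁆∩R∖r₀=∅
    where
    ⁅x₀⁆⊆L : ⁅ x₀ ⁆ ⊆ L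
    ⁅x₀⁆⊆L x x≡x₀ = subst (λ z → L z ≡ true) (sym (∈⁅⁆⇒≡ x≡x₀)) Lx₀

    neighbour : ∃ λ r → (R ∩ N ⁅ x₀ ⁆) r ≡ true
    neighbour =
      count-pos⇒∃ _ (subst (_≤ count (R ∩ N ⁅ x₀ ⁆)) (count-⁅⁆ x₀) (hall ⁅ x₀ ⁆ ⁅x₀⁆⊆L))

    r₀ : Fin n
    r₀ = proj₁ neighbour

    Rr₀ : R r₀ ≡ true
    Rr₀ = ∧-trueˡ (proj₂ neighbour)

    Ex₀r₀ : E x₀ r₀ ≡ true
    Ex₀r₀ with N-elim ⁅ x₀ ⁆ r₀ (∧-trueʳ {R r₀} (proj₂ neighbour))
    ... | y , y≡x₀ , Eyr₀ = subst (λ y → E y r₀ ≡ true) (∈⁅⁆⇒≡ y≡x₀) Eyr₀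

    onx₀ : Matching (L ∩ ⁅ x₀ ⁆) ⁅ r₀ ⁆
    onx₀ = record
      { mate           = λ _ → r₀
      ; mate∈          = λ _ _ → ∈⁅self⁆ r₀
      ; mate-edge      = λ x e → subst (λ y → E y r₀ ≡ true) (sym (∈⁅⁆⇒≡ (∧-trueʳ {L x} e))) Ex₀r₀
      ; mate-injective = λ x y ex ey _ →
                           trans (∈⁅⁆⇒≡ (∧-trueʳ {L x} ex)) (sym (∈⁅⁆⇒≡ (∧-trueʳ {L y} ey)))
      }

    R′ : Pred𝔹 n
    R′ = R ∖ ⁅ r₀ ⁆

    shifted : ∀ Z → (R ∩ N Z) ∖ ⁅ r₀ ⁆ ⊆ R′ ∩ N Z
    shifted Z z e =
      ∧-true (∧-true (∧-trueˡ (∧-trueˡ e)) (∧-trueʳ {R z ∧ N Z z} e)) (∧-trueʳ {R z} (∧-trueˡ e))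

    hall′ : HallCondition (L ∖ ⁅ x₀ ⁆) R′
    hall′ Z Z⊆ with 0 <? count Z
    ... | no ¬pos = ≤-trans (≮⇒≥ ¬pos) z≤n
    ... | yes pos = ≤-pred (begin-strict
      count Z                         <⟨ surplus Z Z⊆ pos ⟩
      count (R ∩ N Z)                 ≤⟨ count-cover (R ∩ N Z) ⁅ r₀ ⁆ (λ z → ∧-trueʳ {(R ∩ N Z) z})
                                                                       (shifted Z) ⟩
      count ⁅ r₀ ⁆ + count (R′ ∩ N Z) ≡⟨ cong (_+ count (R′ ∩ N Z)) (count-⁅⁆ r₀) ⟩
      suc (count (R′ ∩ N Z))          ∎)
      where open ≤-Reasoning

    offx₀ : Matching (L ∖ ⁅ x₀ ⁆) R′
    offx₀ = hall≤k _ _ |L∖x₀|≤k hall′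

    ⁅r₀⁆⊆R : ⁅ r₀ ⁆ ⊆ R
    ⁅r₀⁆⊆R z z≡r₀ = subst (λ z → R z ≡ true) (sym (∈⁅⁆⇒≡ z≡r₀)) Rr₀

    ⁅r₀⁆∩R∖r₀=∅ : Disjoint ⁅ r₀ ⁆ R′
    ⁅r₀⁆∩R∖r₀=∅ z in₁ in₂ = true⇒≢false in₁ (not-true⇒false (∧-trueʳ {R z} in₂))

  -- Induction on |L| (Halmos–Vaughan): if some nonempty Y ⊊ L is critical, match Y into N Y
  -- and L ∖ Y outside N Y; otherwise every such Y has surplus, so x₀ may take any neighbour.
  hall-step : ∀ {k} → Hall≤ k → Hall≤ (suc k)
  hall-step hall≤k L R |L|≤1+k hall with any? (λ x → L x 𝔹.≟ true)
  ... | no L=∅ = matching-∅ (λ x Lx → L=∅ (x , Lx))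
  ... | yes (x₀ , Lx₀)
      with critical? (L ∖ ⁅ x₀ ⁆) R
         | ≤-pred (<-≤-trans (count-∖< L ⁅ x₀ ⁆ (count-pos _ x₀ (∧-true Lx₀ (∈⁅self⁆ x₀)))) |L|≤1+k)
  ...   | yes (p , Y⊆L∖x₀ , pos , crit) | |L∖x₀|≤k =
    matching-from-critical hall≤k |L|≤1+k hall (lookup p) (λ x → ∧-trueˡ ∘ Y⊆L∖x₀ x) pos
      (≤-trans (count-mono Y⊆L∖x₀) |L∖x₀|≤k) crit
  ...   | no ∄ | |L∖x₀|≤k =
    matching-from-surplus hall≤k hall x₀ Lx₀ |L∖x₀|≤k (no-critical⇒surplus ∄)

  hall-bounded : ∀ k → Hall≤ k
  hall-bounded zero    L R |L|≤0 _ = matching-∅ λ x Lx → n≮0 (<-≤-trans (count-pos L x Lx) |L|≤0)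
  hall-bounded (suc k) = hall-step (hall-bounded k)

  hall : ∀ L R → HallCondition L R → Matching L R
  hall L R = hall-bounded n L R (count≤n L)

-- Matching the complement of a maximum independent set into it

adj-sym : ∀ (G : Graph n) {u v} → adj G u v ≡ true → adj G v u ≡ true
adj-sym G {u} {v} = trans (Graph.sym G v u)

Independent𝔹 : Graph n → Pred𝔹 n → Set
Independent𝔹 G J = ∀ u v → J u ≡ true → J v ≡ true → adj G u v ≡ false

MaximumIndependent𝔹 : Graph n → Pred𝔹 n → Set
MaximumIndependent𝔹 G I = Independent𝔹 G I × (∀ J → Independent𝔹 G J → count J ≤ count I)

ProperColouring : Graph n → (Fin n → Bool) → Set
ProperColouring G c = ∀ u v → adj G u v ≡ true → c u ≢ c v

independent-lookup : (G : Graph n) {I : Subset n} → Independent G I → Independent𝔹 G (lookup I)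
independent-lookup G {I} I-indep u v Iu Iv = I-indep u v (lookup⇒[]= u I Iu) (lookup⇒[]= v I Iv)

independent-tabulate : (G : Graph n) (J : Pred𝔹 n) → Independent𝔹 G J → Independent G (tabulate J)
independent-tabulate G J J-indep u v u∈J v∈J =
  J-indep u v (∈-tabulate⁻ J u∈J) (∈-tabulate⁻ J v∈J)

module _ (G : Graph n) where
  open Hall (adj G)

  -- Y ∪ (I ∖ N Y) is independent, hence no larger than I; cancel |I ∖ N Y|.
  maximum-independent-hall : ∀ I A → MaximumIndependent𝔹 G I → Independent𝔹 G A → HallCondition (∁ I ∩ A) I
  maximum-independent-hall I A (I-indep , I-max) A-indep Y Y⊆ = +-cancelʳ-≤ (count (I ∖ N Y)) _ _ (begin
    count Y + count (I ∖ N Y)         ≡⟨ count-∪ Y (I ∖ N Y) Y∩I∖NY=∅ ⟨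
    count (Y ∪ (I ∖ N Y))             ≤⟨ I-max _ independent ⟩
    count I                           ≡⟨ count-split I (N Y) ⟩
    count (I ∩ N Y) + count (I ∖ N Y) ∎)
    where
    open ≤-Reasoning

    Y∩I∖NY=∅ : Disjoint Y (I ∖ N Y)
    Y∩I∖NY=∅ x Yx I∖NYx =
      true⇒≢false (∧-trueˡ {I x} I∖NYx) (not-true⇒false (∧-trueˡ {not (I x)} (Y⊆ x Yx)))

    independent : Independent𝔹 G (Y ∪ (I ∖ N Y))
    independent u v Ju Jv with ∨-true⁻ (Y u) Ju | ∨-true⁻ (Y v) Jv
    ... | inj₁ Yu | inj₁ Yv =
      A-indep u v (∧-trueʳ {not (I u)} (Y⊆ u Yu)) (∧-trueʳ {not (I v)} (Y⊆ v Yv))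
    ... | inj₁ Yu | inj₂ I∖NYv = 𝔹.¬-not λ e →
      true⇒≢false (N-intro Y u v Yu e) (not-true⇒false (∧-trueʳ {I v} I∖NYv))
    ... | inj₂ I∖NYu | inj₁ Yv = 𝔹.¬-not λ e →
      true⇒≢false (N-intro Y v u Yv (adj-sym G e)) (not-true⇒false (∧-trueʳ {I u} I∖NYu))
    ... | inj₂ I∖NYu | inj₂ I∖NYv = I-indep u v (∧-trueˡ I∖NYu) (∧-trueˡ I∖NYv)

  monochromatic-independent : ∀ c → ProperColouring G c →
    ∀ A → (∀ u v → A u ≡ true → A v ≡ true → c u ≡ c v) → Independent𝔹 G A
  monochromatic-independent c proper A mono u v Au Av = 𝔹.¬-not λ e → proper u v e (mono u v Au Av)

  -- A mate has the other colour, so the two colour classes are matched into disjoint parts of I.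
  bipartite-matching : ∀ c → ProperColouring G c → ∀ I → MaximumIndependent𝔹 G I → Matching (∁ I) I
  bipartite-matching c proper I I-max =
    matching-glue c from-c from-∁c (λ _ → ∧-trueˡ) (λ _ → ∧-trueˡ) I∩∁c∩I∩c=∅
    where
    class-hall : ∀ A → (∀ u v → A u ≡ true → A v ≡ true → c u ≡ c v) → HallCondition (∁ I ∩ A) I
    class-hall A mono =
      maximum-independent-hall I A I-max (monochromatic-independent c proper A mono)

    from-c : Matching (∁ I ∩ c) (I ∩ ∁ c)
    from-c = matching-∩ʳ (λ x y Lx e → trans (sym (𝔹.¬-not (proper x y e))) (∧-trueʳ {not (I x)} Lx))
               (hall _ _ (class-hall c λ u v cu cv → trans cu (sym cv)))

    from-∁c : Matching (∁ I ∖ c) (I ∩ c)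
    from-∁c = matching-∩ʳ (λ x y Lx e → trans (𝔹.¬-not (proper y x (adj-sym G e))) (∧-trueʳ {not (I x)} Lx))
                (hall _ _ (class-hall (∁ c) λ u v cu cv → trans (not-true⇒false cu) (sym (not-true⇒false cv))))

    I∩∁c∩I∩c=∅ : Disjoint (I ∩ ∁ c) (I ∩ c)
    I∩∁c∩I∩c=∅ z in₁ in₂ = true⇒≢false (∧-trueʳ {I z} in₂) (not-true⇒false (∧-trueʳ {I z} in₁))

-- Locating-dominating sets

module _ {G : Graph n} (D : Orientation G) where

  arc-irreflexive : ∀ {w z} → arc D w z ≡ true → w ≢ z
  arc-irreflexive {w} w→w refl = true⇒≢false (arc⇒edge D w w w→w) (irrefl G w)

  source∈locating-dominating : ∀ S → LocatingDominating D S → ∀ u → (∀ w → arc D w u ≡ false) → u ∈ S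
  source∈locating-dominating S (dominating , _) u source with u ∈? S
  ... | yes u∈S = u∈S
  ... | no  u∉S with dominating u u∉S
  ...   | w , _ , w→u = ⊥-elim (true⇒≢false w→u (source w))

module _ (G : Graph n) (I : Pred𝔹 n) (M : Hall.Matching (adj G) (∁ I) I) (D : Orientation G) where
  open Hall (adj G) using (mate; mate∈; mate-edge; mate-injective)

  MatchedTo : Fin n → Fin n → Set
  MatchedTo w z = ∁ I w ≡ true × mate M w ≡ z

  Partners : Fin n → Fin n → Bool
  Partners w z = (∁ I w ∧ ⁅ z ⁆ (mate M w)) ∨ (∁ I z ∧ ⁅ w ⁆ (mate M z))

  partners⁺ : ∀ {w z} → MatchedTo w z → Partners w z ≡ true
  partners⁺ {w} (w∉I , refl) rewrite w∉I | ∈⁅self⁆ (mate M w) = refl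

  partners⁻ : ∀ {w z} → Partners w z ≡ true → MatchedTo w z ⊎ MatchedTo z w
  partners⁻ {w} {z} p with ∨-true⁻ (∁ I w ∧ ⁅ z ⁆ (mate M w)) p
  ... | inj₁ wz = inj₁ (∧-trueˡ wz , ∈⁅⁆⇒≡ (∧-trueʳ {∁ I w} wz))
  ... | inj₂ zw = inj₂ (∧-trueˡ zw , ∈⁅⁆⇒≡ (∧-trueʳ {∁ I z} zw))

  partners-sym : ∀ {w z} → Partners w z ≡ true → Partners z w ≡ true
  partners-sym {w} {z} = trans (𝔹.∨-comm (∁ I z ∧ ⁅ w ⁆ (mate M z)) _)

  matched-into-I : ∀ {w z} → MatchedTo w z → I z ≡ true
  matched-into-I {w} (w∉I , refl) = mate∈ M w w∉I

  partners-unique : ∀ {w z z′} → Partners w z ≡ true → Partners w z′ ≡ true → z ≡ z′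
  partners-unique p p′ with partners⁻ p | partners⁻ p′
  ... | inj₁ (_ , wz) | inj₁ (_ , wz′) = trans (sym wz) wz′
  ... | inj₁ (w∉I , _) | inj₂ z′w       = ⊥-elim (true⇒≢false (matched-into-I z′w) (not-true⇒false w∉I))
  ... | inj₂ zw       | inj₁ (w∉I , _) = ⊥-elim (true⇒≢false (matched-into-I zw) (not-true⇒false w∉I))
  ... | inj₂ (z∉I , zw) | inj₂ (z′∉I , z′w) = mate-injective M _ _ z∉I z′∉I (trans zw (sym z′w))

  partners-adjacent : ∀ {w z} → Partners w z ≡ true → adj G w z ≡ true
  partners-adjacent p with partners⁻ p
  ... | inj₁ (w∉I , refl) = mate-edge M _ w∉I
  ... | inj₂ (z∉I , refl) = adj-sym G (mate-edge M _ z∉I)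

  Head : Pred𝔹 n
  Head z = any𝔹 λ w → Partners w z ∧ arc D w z

  head⁺ : ∀ {w z} → Partners w z ≡ true → arc D w z ≡ true → Head z ≡ true
  head⁺ {w} {z} p w→z = any𝔹-intro (λ w → Partners w z ∧ arc D w z) w (∧-true p w→z)

  head⁻ : ∀ {z} → Head z ≡ true → ∃ λ w → Partners w z ≡ true × arc D w z ≡ true
  head⁻ {z} hz with any𝔹-elim _ hz
  ... | w , p∧a = w , ∧-trueˡ p∧a , ∧-trueʳ {Partners w z} p∧a

  tail-not-head : ∀ {w z} → Partners w z ≡ true → arc D w z ≡ true → Head w ≡ false
  tail-not-head {w} {z} p w→z = 𝔹.¬-not λ hw → case-head (head⁻ hw)
    where
    case-head : (∃ λ w′ → Partners w′ w ≡ true × arc D w′ w ≡ true) → ⊥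
    case-head (w′ , p′ , w′→w) with partners-unique p (partners-sym p′)
    ... | refl = true⇒≢false w′→w (antisym D w z w→z)

  partner-is-head : ∀ {w z} → Partners w z ≡ true → Head w ≡ true ⊎ Head z ≡ true
  partner-is-head {w} {z} p with edge⇒arc D w z (partners-adjacent p)
  ... | inj₁ w→z = inj₂ (head⁺ p w→z)
  ... | inj₂ z→w = inj₁ (head⁺ (partners-sym p) z→w)

  Tails : Subset n
  Tails = tabulate (∁ Head)

  ∉Tails⇒head : ∀ {u} → u ∉ Tails → Head u ≡ true
  ∉Tails⇒head {u} u∉T with Head u in hu
  ... | true  = refl
  ... | false = ⊥-elim (u∉T (∈-tabulate⁺ (∁ Head) (false⇒not-true hu)))

  tail-of : ∀ u → u ∉ Tails → ∃ λ w → w ∈ Tails × arc D w u ≡ true × Partners w u ≡ true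
  tail-of u u∉T with head⁻ (∉Tails⇒head u∉T)
  ... | w , p , w→u = w , ∈-tabulate⁺ (∁ Head) (false⇒not-true (tail-not-head p w→u)) , w→u , p

  tails-locating-dominating : ¬ HasC4 G → LocatingDominating D Tails
  tails-locating-dominating C4-free = dominating , locating
    where
    dominating : ∀ u → u ∉ Tails → Σ (Fin n) λ w → w ∈ Tails × arc D w u ≡ true
    dominating u u∉T with tail-of u u∉T
    ... | w , w∈T , w→u , _ = w , w∈T , w→u

    locating : ∀ u v → u ∉ Tails → v ∉ Tails → u ≢ v → ¬ (∀ w → w ∈ Tails → arc D w u ≡ arc D w v)
    locating u v u∉T v∉T u≢v same with tail-of u u∉T | tail-of v v∉T
    ... | wu , wu∈T , wu→u , pu | wv , wv∈T , wv→v , pv = C4-free (u , wu , v , wv , distinct , cycle)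
      where
      wu→v : arc D wu v ≡ true
      wu→v = trans (sym (same wu wu∈T)) wu→u
      wv→u : arc D wv u ≡ true
      wv→u = trans (same wv wv∈T) wv→v
      wu≢wv : wu ≢ wv
      wu≢wv refl = u≢v (partners-unique pu pv)
      distinct = arc-irreflexive D wu→u ∘ sym , u≢v , arc-irreflexive D wv→u ∘ sym ,
                 arc-irreflexive D wu→v , wu≢wv , arc-irreflexive D wv→v ∘ sym
      cycle = adj-sym G (arc⇒edge D wu u wu→u) , arc⇒edge D wu v wu→v ,
              adj-sym G (arc⇒edge D wv v wv→v) , arc⇒edge D wv u wv→u

  ∣Tails∣≤count : ∣ Tails ∣ ≤ count I
  ∣Tails∣≤count = subst (_≤ count I) (sym (∣tabulate∣≡count (∁ Head)))
                    (count-injection (∁ Head) I into-I into-I∈I into-I-injective)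
    where
    into-I : Fin n → Fin n
    into-I x = if I x then x else mate M x

    into-I∈I : ∀ x → ∁ Head x ≡ true → I (into-I x) ≡ true
    into-I∈I x _ with I x in Ix
    ... | true  = Ix
    ... | false = mate∈ M x (false⇒not-true Ix)

    not-both-tails : ∀ {w z} → Partners w z ≡ true → ∁ Head w ≡ true → ∁ Head z ≡ true → ⊥
    not-both-tails p tw tz with partner-is-head p
    ... | inj₁ hw = true⇒≢false hw (not-true⇒false tw)
    ... | inj₂ hz = true⇒≢false hz (not-true⇒false tz)

    into-I-∈ : ∀ {x} → I x ≡ true → into-I x ≡ x
    into-I-∈ Ix rewrite Ix = refl

    into-I-∉ : ∀ {x} → I x ≡ false → into-I x ≡ mate M x
    into-I-∉ Ix rewrite Ix = refl

    into-I-injective : ∀ x y → ∁ Head x ≡ true → ∁ Head y ≡ true → into-I x ≡ into-I y → x ≡ y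
    into-I-injective x y tx ty same with 𝔹-cases (I x) | 𝔹-cases (I y)
    ... | inj₁ Ix | inj₁ Iy = trans (sym (into-I-∈ Ix)) (trans same (into-I-∈ Iy))
    ... | inj₂ Ix | inj₂ Iy = mate-injective M x y (false⇒not-true Ix) (false⇒not-true Iy)
                                (trans (sym (into-I-∉ Ix)) (trans same (into-I-∉ Iy)))
    ... | inj₁ Ix | inj₂ Iy = ⊥-elim (not-both-tails (partners⁺ (false⇒not-true Iy , mate-y≡x)) ty tx)
      where mate-y≡x = trans (sym (into-I-∉ Iy)) (trans (sym same) (into-I-∈ Ix))
    ... | inj₂ Ix | inj₁ Iy = ⊥-elim (not-both-tails (partners⁺ (false⇒not-true Ix , mate-x≡y)) tx ty)
      where mate-x≡y = trans (sym (into-I-∉ Ix)) (trans same (into-I-∈ Iy))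

module _ (G : Graph n) (c : Fin n → Bool) (proper : ProperColouring G c)
         (I : Pred𝔹 n) (I-indep : Independent𝔹 G I) where

  precedes : Fin n → Fin n → Bool
  precedes u v = I u ∨ (∁ I v ∧ c u)

  precedes-flip : ∀ u v → adj G u v ≡ true → precedes v u ≡ not (precedes u v)
  precedes-flip u v e =
    truth-table (I u) (I v) (c u) (c v) (𝔹.¬-not (proper v u (adj-sym G e)))
      (λ Iu Iv → true⇒≢false e (I-indep u v Iu Iv))
    where
    truth-table : ∀ a b p q → q ≡ not p → (a ≡ true → b ≡ true → ⊥) →
      b ∨ (not a ∧ q) ≡ not (a ∨ (not b ∧ p))
    truth-table true  true  _ _ _    ¬both = ⊥-elim (¬both refl refl)
    truth-table true  false _ _ refl _     = refl
    truth-table false true  _ _ refl _     = refl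
    truth-table false false _ _ refl _     = refl

  sources-first : Orientation G
  sources-first = record
    { arc      = arc₀
    ; arc⇒edge = λ _ _ → ∧-trueˡ
    ; edge⇒arc = arc₀-total
    ; antisym  = arc₀-antisym
    }
    where
    arc₀ : Fin n → Fin n → Bool
    arc₀ u v = adj G u v ∧ precedes u v

    arc₀-total : ∀ u v → adj G u v ≡ true → arc₀ u v ≡ true ⊎ arc₀ v u ≡ true
    arc₀-total u v e with 𝔹-cases (precedes u v)
    ... | inj₁ u≺v = inj₁ (∧-true e u≺v)
    ... | inj₂ u≺v = inj₂ (∧-true (adj-sym G e) (trans (precedes-flip u v e) (cong not u≺v)))

    arc₀-antisym : ∀ u v → arc₀ u v ≡ true → arc₀ v u ≡ false
    arc₀-antisym u v u→v = trans
      (cong (adj G v u ∧_) (trans (precedes-flip u v e) (cong not (∧-trueʳ {adj G u v} u→v))))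
      (𝔹.∧-zeroʳ (adj G v u))
      where e = ∧-trueˡ u→v

  sources-first-source : ∀ u → I u ≡ true → ∀ w → arc sources-first w u ≡ false
  sources-first-source u Iu w = 𝔹.¬-not λ w→u →
    case-precedes (∧-trueˡ w→u) (∨-true⁻ (I w) (∧-trueʳ {adj G w u} w→u))
    where
    case-precedes : adj G w u ≡ true → I w ≡ true ⊎ (∁ I u ∧ c w) ≡ true → ⊥
    case-precedes e (inj₁ Iw)  = true⇒≢false e (I-indep w u Iw Iu)
    case-precedes _ (inj₂ u∉I) = true⇒≢false Iu (not-true⇒false (∧-trueˡ u∉I))

γLD≤α : (G : Graph n) → Bipartite G → ¬ HasC4 G →
  ∀ k → IsIndependenceNumber G k → ∀ D → Σ (Subset n) λ S → LocatingDominating D S × ∣ S ∣ ≤ k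
γLD≤α {n} G (c , proper) C4-free k ((I , I-indep , ∣I∣≡k) , I-max) D =
  Tails G I𝔹 M D ,
  tails-locating-dominating G I𝔹 M D C4-free ,
  subst (∣ Tails G I𝔹 M D ∣ ≤_) count-I𝔹 (∣Tails∣≤count G I𝔹 M D)
  where
  I𝔹 : Pred𝔹 n
  I𝔹 = lookup I

  count-I𝔹 : count I𝔹 ≡ k
  count-I𝔹 = trans (sym (∣∣≡count-lookup I)) ∣I∣≡k

  M : Hall.Matching (adj G) (∁ I𝔹) I𝔹
  M = bipartite-matching G c proper I𝔹 (independent-lookup G I-indep , λ J J-indep →
        subst₂ _≤_ (∣tabulate∣≡count J) (sym count-I𝔹)
                   (I-max (tabulate J) (independent-tabulate G J J-indep)))

sources-first-γLD≥α : (G : Graph n) → Bipartite G →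
  ∀ k → IsIndependenceNumber G k → Σ (Orientation G) λ D → ∀ S → LocatingDominating D S → k ≤ ∣ S ∣
sources-first-γLD≥α G (c , proper) k ((I , I-indep , ∣I∣≡k) , _) =
  D₀ , λ S S-ld → subst (_≤ ∣ S ∣) ∣I∣≡k (p⊆q⇒∣p∣≤∣q∣ {p = I} λ {u} u∈I →
    source∈locating-dominating D₀ S S-ld u (source u ([]=⇒lookup u∈I)))
  where
  I𝔹-indep = independent-lookup G I-indep
  D₀ = sources-first G c proper (lookup I) I𝔹-indep
  source = sources-first-source G c proper (lookup I) I𝔹-indep

corollary34 : ∀ (n : ℕ) (G : Graph n) → Bipartite G → ¬ HasC4 G →
    ∀ (k : ℕ) → IsIndependenceNumber G k → IsUpperOrientedLDNumber G k
corollary34 n G bipartite C4-free k α =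
  let (D₀ , k≤) = sources-first-γLD≥α G bipartite k α
      upper = γLD≤α G bipartite C4-free k α
      (S₀ , S₀-ld , ∣S₀∣≤k) = upper D₀
  in (D₀ , (S₀ , S₀-ld , ≤-antisym ∣S₀∣≤k (k≤ S₀ S₀-ld)) , k≤) ,
     λ D m (_ , minimal) → let (S , S-ld , ∣S∣≤k) = upper D in ≤-trans (minimal S S-ld) ∣S∣≤k
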